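{- Let $G$ be a graph, $r$ a positive integer and $k$ an integer. Let $L_S$ be an extendable subordering with free vertices $T=V(G)\setminus S$, and assume there is a full right extension $L'$ of $L_S$ with $\mathrm{wcol}_r(G,L')\le k$. If $u\in T$ satisfies $|\mathrm{Wreach}_r(G,L_S,u)|=k$, then there is a full right extension $\overline{L}$ of $L_S$ in which $u$ is the leftmost vertex of $T$ and $\mathrm{wcol}_r(G,\overline{L})\le k$.
   Context: All graphs are finite, simple and undirected. The length of a path is its number of edges (a single vertex is a path of length $0$). A subordering $L_S$ of a graph $G$ is a linear ordering of a subset $S\subseteq V(G)$; vertices of $V(G)\setminus S$ are called free. We write $u\preceq_{L_S} w$ if $u=w$ or $u$ precedes $w$. Given a subordering $L_S$ and vertices $u,x\in V(G)$, we say $u\in \mathrm{Wreach}_r(G,L_S,x)$ if either $u=x$, or $u\in S$ and there is a path $P$ between $u$ and $x$ of length at most $r$ such that $u\preceq_{L_S} w$ for all $w\in V(P)\cap S$ (for an ordering of all of $V(G)$ this is the usual weak $r$-reachability). Let $\mathrm{wcol}_r(G,L_S)=\max_{x\in V(G)}|\mathrm{Wreach}_r(G,L_S,x)|$; $L_S$ is extendable if $\mathrm{wcol}_r(G,L_S)\le k$. A subordering $L_{S'}$ with $S'\supseteq S$ is a right extension of $L_S$ if it restricts to $L_S$ on $S$ and all vertices of $S$ precede all vertices of $S'\setminus S$; it is a full right extension if $S'=V(G)$. -}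

module Defs where

open import Level using (0ℓ)
open import Data.Nat using (ℕ; suc; _≤_)
open import Data.Fin using (Fin)
open import Data.List using (List; []; _∷_; _++_; length)
open import Data.List.Membership.Propositional using (_∈_)
open import Data.List.Relation.Unary.All using (All)
open import Data.List.Relation.Unary.Unique.Propositional using (Unique)
open import Data.Product using (Σ; ∃; ∃-syntax; _×_; _,_)
open import Data.Sum using (_⊎_)
open import Relation.Binary.PropositionalEquality using (_≡_)
open import Relation.Nullary using (¬_)

record Graph (n : ℕ) : Set₁ where
  field
    Adj       : Fin n → Fin n → Set
    symmetric : ∀ {x y} → Adj x y → Adj y x
    irreflex  : ∀ {x} → ¬ Adj x x
open Graph public

-- A subordering of G: a duplicate-free list of vertices (the set S, in order).
Subordering : ℕ → Set
Subordering n = Σ (List (Fin n)) Unique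

module _ {n : ℕ} where

  _≺[_]_ : Fin n → List (Fin n) → Fin n → Set
  u ≺[ L ] w = ∃[ A ] ∃[ B ] (L ≡ A ++ (u ∷ B) × w ∈ B)

  _⪯[_]_ : Fin n → List (Fin n) → Fin n → Set
  u ⪯[ L ] w = u ≡ w ⊎ u ≺[ L ] w

  data Walk (G : Graph n) : Fin n → Fin n → List (Fin n) → Set where
    here : ∀ {x} → Walk G x x (x ∷ [])
    step : ∀ {x y z vs} → Adj G x y → Walk G y z vs → Walk G x z (x ∷ vs)

  -- a path of length at most r (at most r edges) between u and x, with vertex list vs
  ShortPath : Graph n → ℕ → Fin n → Fin n → List (Fin n) → Set
  ShortPath G r u x vs = Walk G u x vs × Unique vs × length vs ≤ suc r

  -- u ∈ Wreach_r(G, L_S, x)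
  Wreach : Graph n → ℕ → Subordering n → Fin n → Fin n → Set
  Wreach G r (L , _) x u =
    u ≡ x ⊎
    (u ∈ L × ∃[ vs ] (ShortPath G r u x vs × All (λ w → w ∈ L → u ⪯[ L ] w) vs))

  CardLe : (Fin n → Set) → ℕ → Set
  CardLe P k = ∀ (xs : List (Fin n)) → Unique xs → All P xs → length xs ≤ k

  CardEq : (Fin n → Set) → ℕ → Set
  CardEq P k = CardLe P k × ∃[ xs ] (Unique xs × All P xs × length xs ≡ k)

  WcolLe : Graph n → ℕ → Subordering n → ℕ → Set
  WcolLe G r L k = ∀ (x : Fin n) → CardLe (Wreach G r L x) k

  FullRightExt : Subordering n → Subordering n → Set
  FullRightExt (L , _) (L' , _) = (∃[ M ] L' ≡ L ++ M) × (∀ (v : Fin n) → v ∈ L')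

  FullRightExtWithFirst : Subordering n → Fin n → Subordering n → Set
  FullRightExtWithFirst (L , _) u (L' , _) =
    (∃[ M ] L' ≡ L ++ (u ∷ M)) × (∀ (v : Fin n) → v ∈ L')

-- Write L' = L_S M₁ u M₂ for the given full right extension and L̄ = L_S u M₁ M₂.
-- Wreach_r(G, L_S, u) ⊆ Wreach_r(G, L', u), and both sets have at most k elements while the
-- first has exactly k, so no free vertex other than u is weakly r-reachable from u in L'.
-- Hence no vertex of a short path from u through free vertices precedes u in L': the first
-- one that did would be weakly r-reachable from u along the reversed prefix of the path.
-- This gives Wreach_r(G, L̄, x) ⊆ Wreach_r(G, L', x) for every x: for u by the observation
-- just made, and for every other vertex v because v ⪯ w in L̄ implies v ⪯ w in L'.
module Submission where

open import Defs
open import Data.Nat using (ℕ; _<_; suc; _≤_)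
open import Data.Nat.Properties using (≤-trans; <-irrefl)
open import Data.Fin using (Fin)
open import Data.Fin.Properties using (_≟_)
open import Data.Product using (∃-syntax; _×_; proj₁; _,_)
open import Data.Sum using (_⊎_; inj₁; inj₂)
import Data.Sum as Sum
open import Data.Empty using (⊥-elim)
open import Function using (_∘_; id)
open import Data.List using (List; []; _∷_; _++_; [_]; reverse)
open import Data.List.Properties using (unfold-reverse; length-reverse)
open import Data.List.Membership.Propositional using (_∈_; _∉_)
open import Data.List.Membership.Propositional.Properties using (∈-∃++; ∈-++⁻; ∈-++⁺ˡ; ∈-++⁺ʳ)
open import Data.List.Relation.Unary.Any using (here; there)
open import Data.List.Relation.Unary.All as All using (All; []; _∷_)
open import Data.List.Relation.Unary.All.Properties using (++⁺; ++⁻ʳ)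
open import Data.List.Relation.Unary.AllPairs using ([]; _∷_)
open import Data.List.Relation.Unary.Unique.Propositional using (Unique)
open import Data.List.Relation.Binary.Sublist.Propositional using (_⊆_; []; _∷_; _∷ʳ_; ⊆-refl; lookup; minimum)
open import Data.List.Relation.Binary.Sublist.Propositional.Properties
  using (length-mono-≤; All-resp-⊆) renaming (++⁺ to ⊆-++⁺; ++⁺ʳ to ⊆-++⁺ʳ)
open import Data.List.Relation.Binary.Permutation.Propositional using (_↭_; ↭-sym; ↭⇒↭ₛ)
open import Data.List.Relation.Binary.Permutation.Propositional.Properties
  using (↭-reverse; shift; ∈-resp-↭; All-resp-↭) renaming (++⁺ˡ to ↭-++⁺ˡ)
import Data.List.Relation.Binary.Permutation.Setoid.Properties as Permutationₛ
open import Relation.Binary.PropositionalEquality using (_≡_; _≢_; refl; sym; cong; subst; setoid)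
open import Relation.Nullary using (¬_; yes; no)

module _ {n : ℕ} where

  private
    variable
      u v w x y z : Fin n
      xs ys zs : List (Fin n)

  data Precedes (v w : Fin n) : List (Fin n) → Set where
    here  : w ∈ xs → Precedes v w (v ∷ xs)
    there : Precedes v w xs → Precedes v w (x ∷ xs)

  ≺⇒Precedes : v ≺[ xs ] w → Precedes v w xs
  ≺⇒Precedes ([]    , _ , refl , w∈) = here w∈
  ≺⇒Precedes (_ ∷ A , B , refl , w∈) = there (≺⇒Precedes (A , B , refl , w∈))

  Precedes⇒≺ : Precedes v w xs → v ≺[ xs ] w
  Precedes⇒≺ (here {xs} w∈) = [] , xs , refl , w∈
  Precedes⇒≺ (there {x = a} p) with A , B , refl , w∈ ← Precedes⇒≺ p = a ∷ A , B , refl , w∈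

  ⪯-map : (Precedes v w xs → Precedes v w ys) → v ⪯[ xs ] w → v ⪯[ ys ] w
  ⪯-map f = Sum.map id (Precedes⇒≺ ∘ f ∘ ≺⇒Precedes)

  Precedes⇒∈ʳ : Precedes v w xs → w ∈ xs
  Precedes⇒∈ʳ (here w∈)  = there w∈
  Precedes⇒∈ʳ (there p) = there (Precedes⇒∈ʳ p)

  Precedes-⊆ : xs ⊆ ys → Precedes v w xs → Precedes v w ys
  Precedes-⊆ (_ ∷ʳ τ)   p         = there (Precedes-⊆ τ p)
  Precedes-⊆ (refl ∷ τ) (here w∈) = here (lookup τ w∈)
  Precedes-⊆ (refl ∷ τ) (there p) = there (Precedes-⊆ τ p)

  Precedes-++ : v ∈ xs → w ∈ ys → Precedes v w (xs ++ ys)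
  Precedes-++ {xs = _ ∷ xs} (here refl) w∈ = here (∈-++⁺ʳ xs w∈)
  Precedes-++ (there v∈) w∈ = there (Precedes-++ v∈ w∈)

  Precedes-total : v ∈ xs → w ∈ xs → v ≢ w → Precedes v w xs ⊎ Precedes w v xs
  Precedes-total (here refl) (here refl) v≢w = ⊥-elim (v≢w refl)
  Precedes-total (here refl) (there w∈)  _   = inj₁ (here w∈)
  Precedes-total (there v∈)  (here refl) _   = inj₂ (here v∈)
  Precedes-total (there v∈)  (there w∈)  v≢w = Sum.map there there (Precedes-total v∈ w∈ v≢w)

  Precedes-trans : Unique xs → Precedes u v xs → Precedes v w xs → Precedes u w xs
  Precedes-trans (u∉ ∷ _)  (here v∈)  (here _)  = ⊥-elim (All.lookup u∉ v∈ refl)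
  Precedes-trans _         (here _)   (there q) = here (Precedes⇒∈ʳ q)
  Precedes-trans (v∉ ∷ _)  (there p)  (here _)  = ⊥-elim (All.lookup v∉ (Precedes⇒∈ʳ p) refl)
  Precedes-trans (_ ∷ xs!) (there p)  (there q) = there (Precedes-trans xs! p q)

  Precedes-∉ˡ : ∀ xs → Unique (xs ++ ys) → v ∉ xs → Precedes v w (xs ++ ys) → w ∉ xs
  Precedes-∉ˡ (_ ∷ _)  _         v∉ (here _)  _           = v∉ (here refl)
  Precedes-∉ˡ (_ ∷ _)  (a∉ ∷ _)  _  (there p) (here refl) = All.lookup a∉ (Precedes⇒∈ʳ p) refl
  Precedes-∉ˡ (_ ∷ xs) (_ ∷ xs!) v∉ (there p) (there w∈)  = Precedes-∉ˡ xs xs! (v∉ ∘ there) p w∈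

  Precedes-postpone : ∀ xs → v ≢ u →
    Precedes v w (xs ++ u ∷ ys ++ zs) → Precedes v w (xs ++ ys ++ u ∷ zs)
  Precedes-postpone []       v≢u (here _)  = ⊥-elim (v≢u refl)
  Precedes-postpone []       _   (there p) = Precedes-⊆ (⊆-++⁺ ⊆-refl (_ ∷ʳ ⊆-refl)) p
  Precedes-postpone {ys = ys} {zs} (_ ∷ xs) _ (here w∈) =
    here (∈-resp-↭ (↭-++⁺ˡ xs (↭-sym (shift _ ys zs))) w∈)
  Precedes-postpone (_ ∷ xs) v≢u (there p) = there (Precedes-postpone xs v≢u p)

  moveFirst-↭ : ∀ L M₁ M₂ → L ++ M₁ ++ u ∷ M₂ ↭ L ++ u ∷ M₁ ++ M₂
  moveFirst-↭ {u = u} L M₁ M₂ = ↭-++⁺ˡ L (shift u M₁ M₂)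

  Unique-⊆ : xs ⊆ ys → Unique ys → Unique xs
  Unique-⊆ []         []         = []
  Unique-⊆ (_ ∷ʳ τ)   (_ ∷ ys!)  = Unique-⊆ τ ys!
  Unique-⊆ (refl ∷ τ) (y∉ ∷ ys!) = All-resp-⊆ τ y∉ ∷ Unique-⊆ τ ys!

  Unique-↭ : xs ↭ ys → Unique xs → Unique ys
  Unique-↭ σ = Permutationₛ.Unique-resp-↭ (setoid (Fin n)) (↭⇒↭ₛ σ)

  module _ {G : Graph n} where

    Walk-∷ʳ : Walk G x y xs → Adj G y z → Walk G x z (xs ++ [ z ])
    Walk-∷ʳ here        yz = step yz here
    Walk-∷ʳ (step xy w) yz = step xy (Walk-∷ʳ w yz)

    Walk-reverse : Walk G x y xs → Walk G y x (reverse xs)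
    Walk-reverse here = here
    Walk-reverse (step {x} {vs = vs} xy w) rewrite unfold-reverse x vs =
      Walk-∷ʳ (Walk-reverse w) (symmetric G xy)

    Walk-prefix : ∀ xs → Walk G x z (xs ++ y ∷ ys) → Walk G x y (xs ++ [ y ])
    Walk-prefix []           here       = here
    Walk-prefix []           (step _ _) = here
    Walk-prefix (_ ∷ [])     (step e w) = step e (Walk-prefix [] w)
    Walk-prefix (_ ∷ _ ∷ xs) (step e w) = step e (Walk-prefix (_ ∷ xs) w)

    ShortPath-reverse : ∀ {r} → ShortPath G r x y xs → ShortPath G r y x (reverse xs)
    ShortPath-reverse {xs = xs} {r} (w , xs! , len) =
      Walk-reverse w ,
      Unique-↭ (↭-sym (↭-reverse xs)) xs! ,
      subst (_≤ suc r) (sym (length-reverse xs)) len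

    ShortPath-prefix : ∀ {r} xs → ShortPath G r x z (xs ++ y ∷ ys) → ShortPath G r x y (xs ++ [ y ])
    ShortPath-prefix {ys = ys} xs (w , xs! , len) =
      Walk-prefix xs w , Unique-⊆ prefix xs! , ≤-trans (length-mono-≤ prefix) len
      where
        prefix = ⊆-++⁺ ⊆-refl (refl ∷ minimum ys)

  module _ {P Q : Fin n → Set} {k : ℕ} where

    CardLe-⊆ : (∀ {z} → P z → Q z) → CardLe Q k → CardLe P k
    CardLe-⊆ P⊆Q le xs xs! pxs = le xs xs! (All.map P⊆Q pxs)

    CardEq-saturated : CardEq P k → (∀ {z} → P z → Q z) → CardLe Q k → Q y → ¬ ¬ P y
    CardEq-saturated (_ , xs , xs! , pxs , refl) P⊆Q le qy ¬py =
      <-irrefl refl (le (_ ∷ xs) (y∉xs ∷ xs!) (qy ∷ All.map P⊆Q pxs))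
      where
        y∉xs = All.map (λ pz y≡z → ¬py (subst P (sym y≡z) pz)) pxs

  All-from-prefixes : {P : Fin n → Set} →
    (∀ xs y ys → xs ++ y ∷ ys ≡ zs → All P xs → P y) → All P zs
  All-from-prefixes {zs = []}     _ = []
  All-from-prefixes {zs = z ∷ zs} h =
    pz ∷ All-from-prefixes (λ xs y ys eq pxs → h (z ∷ xs) y ys (cong (z ∷_) eq) (pz ∷ pxs))
    where
      pz = h [] z zs refl []

  module _ (G : Graph n) (r : ℕ) where

    Wreach-++ʳ : ∀ {L M} (L! : Unique L) (LM! : Unique (L ++ M)) →
      Wreach G r (L , L!) x z → Wreach G r (L ++ M , LM!) x z
    Wreach-++ʳ _ _ (inj₁ z≡x) = inj₁ z≡x
    Wreach-++ʳ {z = z} {L = L} {M} _ _ (inj₂ (z∈ , vs , path , leftmost)) =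
      inj₂ (∈-++⁺ˡ z∈ , vs , path , All.map extend leftmost)
      where
        extend : (w ∈ L → z ⪯[ L ] w) → w ∈ L ++ M → z ⪯[ L ++ M ] w
        extend z⪯ w∈ with ∈-++⁻ L w∈
        ... | inj₁ w∈L = ⪯-map (Precedes-⊆ (⊆-++⁺ʳ M ⊆-refl)) (z⪯ w∈L)
        ... | inj₂ w∈M = inj₂ (Precedes⇒≺ (Precedes-++ z∈ w∈M))

    module _ {Z : List (Fin n)} (Z! : Unique Z) (covers : ∀ v → v ∈ Z) where

      Wreach-earlier-on-path : ∀ xs → ShortPath G r u x (xs ++ y ∷ ys) →
        All (u ⪯[ Z ]_) xs → Precedes y u Z → Wreach G r (Z , Z!) u y
      Wreach-earlier-on-path {u = u} {y = y} xs path after y≺u =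
        inj₂ (covers y , reverse (xs ++ [ y ]) , ShortPath-reverse (ShortPath-prefix xs path) ,
              All-resp-↭ (↭-sym (↭-reverse (xs ++ [ y ])))
                (++⁺ (All.map (λ u⪯w _ → y⪯ u⪯w) after) ((λ _ → inj₁ refl) ∷ [])))
        where
          y⪯ : u ⪯[ Z ] w → y ⪯[ Z ] w
          y⪯ (inj₁ refl) = inj₂ (Precedes⇒≺ y≺u)
          y⪯ (inj₂ u≺w)  = inj₂ (Precedes⇒≺ (Precedes-trans Z! y≺u (≺⇒Precedes u≺w)))

      ShortPath-stays-after : {P : Fin n → Set} →
        (∀ {y} → P y → y ≢ u → ¬ Wreach G r (Z , Z!) u y) →
        ShortPath G r u x zs → All P zs → All (u ⪯[ Z ]_) zs
      ShortPath-stays-after {u = u} unreachable path pzs = All-from-prefixes next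
        where
          next : ∀ xs y ys → xs ++ y ∷ ys ≡ _ → All (u ⪯[ Z ]_) xs → u ⪯[ Z ] y
          next xs y ys refl after with u ≟ y
          ... | yes u≡y = inj₁ u≡y
          ... | no u≢y with Precedes-total (covers u) (covers y) u≢y
          ...   | inj₁ u≺y = inj₂ (Precedes⇒≺ u≺y)
          ...   | inj₂ y≺u with py ∷ _ ← ++⁻ʳ xs pzs =
            ⊥-elim (unreachable py (u≢y ∘ sym) (Wreach-earlier-on-path xs path after y≺u))

    Wreach-moveFirst-⊆ : ∀ L M₁ M₂
      (Z! : Unique (L ++ M₁ ++ u ∷ M₂)) (Z̄! : Unique (L ++ u ∷ M₁ ++ M₂)) →
      (∀ v → v ∈ L ++ M₁ ++ u ∷ M₂) → (∀ v → v ∈ L ++ u ∷ M₁ ++ M₂) → u ∉ L →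
      (∀ {y} → y ∉ L → y ≢ u → ¬ Wreach G r (L ++ M₁ ++ u ∷ M₂ , Z!) u y) →
      Wreach G r (L ++ u ∷ M₁ ++ M₂ , Z̄!) x v → Wreach G r (L ++ M₁ ++ u ∷ M₂ , Z!) x v
    Wreach-moveFirst-⊆ _ _ _ _ _ _ _ _ _ (inj₁ v≡x) = inj₁ v≡x
    Wreach-moveFirst-⊆ {u = u} {v = v} L M₁ M₂ Z! Z̄! covers covers̄ u∉L unreachable
                       (inj₂ (_ , vs , path , leftmost))
      with v ≟ u
    ... | yes refl =
      inj₂ (covers u , vs , path ,
            All.map (λ u⪯w _ → u⪯w) (ShortPath-stays-after Z! covers unreachable path free))
      where
        after⇒∉L : u ⪯[ L ++ u ∷ M₁ ++ M₂ ] w → w ∉ L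
        after⇒∉L (inj₁ refl) = u∉L
        after⇒∉L (inj₂ u≺w)  = Precedes-∉ˡ L Z̄! u∉L (≺⇒Precedes u≺w)
        free : All (_∉ L) vs
        free = All.map (λ {w} u⪯ → after⇒∉L (u⪯ (covers̄ w))) leftmost
    ... | no v≢u =
      inj₂ (covers v , vs , path ,
            All.map (λ {w} v⪯ _ → ⪯-map (Precedes-postpone L v≢u) (v⪯ (covers̄ w))) leftmost)

proposition10 : ∀ {n : ℕ} (G : Graph n) (r : ℕ) (k : ℕ) (LS : Subordering n) →
    0 < r →
    WcolLe G r LS k →
    (∃[ L' ] (FullRightExt LS L' × WcolLe G r L' k)) →
    (u : Fin n) → u ∉ proj₁ LS →
    CardEq (Wreach G r LS u) k →
    ∃[ Lbar ] (FullRightExtWithFirst LS u Lbar × WcolLe G r Lbar k)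
proposition10 G r k (L , L!) _ _ ((_ , L'!) , ((M , refl) , covers) , wcol') u u∉L card
  with ∈-++⁻ L (covers u)
... | inj₁ u∈L = ⊥-elim (u∉L u∈L)
... | inj₂ u∈M with M₁ , M₂ , refl ← ∈-∃++ u∈M =
  (L ++ u ∷ M₁ ++ M₂ , L̄!) , ((M₁ ++ M₂ , refl) , covers̄) ,
  λ x → CardLe-⊆ (Wreach-moveFirst-⊆ G r L M₁ M₂ L'! L̄! covers covers̄ u∉L unreachable) (wcol' x)
  where
    σ = moveFirst-↭ L M₁ M₂
    L̄! = Unique-↭ σ L'!
    covers̄ = ∈-resp-↭ σ ∘ covers
    unreachable : ∀ {y} → y ∉ L → y ≢ u → ¬ Wreach G r (L ++ M₁ ++ u ∷ M₂ , L'!) u y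
    unreachable y∉L y≢u reach =
      CardEq-saturated card (Wreach-++ʳ G r L! L'!) (wcol' u) reach Sum.[ y≢u , y∉L ∘ proj₁ ]
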